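{- Let $K$ be an ordered differential field and $\dot{\mathcal O}$ a valuation ring of $K$ such that $(K,\dot{\mathcal O})$ is a pre-$H$-field with small derivation. Suppose that $(K,\dot{\mathcal O})$ is residue constant closed and that $\dot K$ (with its induced ordering and derivation) is an $H$-field. Then $K$ is an $H$-field.
   Context: For a differential field $K$, $a'=\partial a$, $C=C_K=\{a:a'=0\}$, $a^\dagger=a'/a$. For a valuation ring $\dot{\mathcal O}\supseteq\mathbb Q$ of $K$ with maximal ideal $\dot{\mathfrak m}$: $f\,\dot\preccurlyeq\, g$ iff $f\in\dot{\mathcal O}g$, $f\,\dot\prec\, g$ iff $f\in\dot{\mathfrak m}g$ and $g\neq 0$. Small derivation means $\partial\dot{\mathfrak m}\subseteq\dot{\mathfrak m}$; then $\partial\dot{\mathcal O}\subseteq\dot{\mathcal O}$ and the residue field $\dot K=\dot{\mathcal O}/\dot{\mathfrak m}$ is a differential field; if $\dot{\mathcal O}$ is convex it is also an ordered field. A pre-$H$-field is $(K,\dot{\mathcal O})$ with $K$ an ordered differential field and $\dot{\mathcal O}$ a valuation ring such that $\dot{\mathcal O}$ is convex, $f>\dot{\mathcal O}$ implies $f'>0$, and for all $f,g\in K^\times$ with $f\,\dot\preccurlyeq\,1$, $g\,\dot\prec\,1$ we have $f'\,\dot\prec\, g^\dagger$. (These force $C\subseteq\dot{\mathcal O}$.) $(K,\dot{\mathcal O})$ is residue constant closed if the residue map $\dot{\mathcal O}\to\dot K$ maps $C_K$ onto $C_{\dot K}$. An $H$-field is an ordered differential field $F$ such that (i) for all $a\in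 F$, $a>C_F$ implies $a'>0$, and (ii) $\operatorname{conv}_F(C_F)=C_F+\mathfrak m$, where $\mathfrak m$ is the maximal ideal of the valuation ring $\operatorname{conv}_F(C_F)$ (the convex hull of $C_F$). -}

module Defs where

open import Level using (Level; _⊔_) renaming (suc to lsuc)
open import Data.Nat using (ℕ; zero; suc)
open import Data.Product using (Σ; Σ-syntax; _×_; _,_; proj₁; proj₂)
open import Data.Sum using (_⊎_)
open import Relation.Nullary using (¬_)
open import Relation.Binary using (Rel; IsTotalOrder)
open import Algebra.Structures using (IsCommutativeRing)

-- Raw ordered differential structures (carrier with setoid equality,
-- order, ring operations and a derivation).  Used to state the H-field
-- axioms uniformly for K and for its residue field.

record RawODF (c ℓ : Level) : Set (lsuc (c ⊔ ℓ)) where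
  infix  4 _≈_ _≤_
  infixl 6 _+_
  infixl 7 _*_
  field
    Carrier : Set c
    _≈_     : Rel Carrier ℓ
    _≤_     : Rel Carrier ℓ
    _+_     : Carrier → Carrier → Carrier
    _*_     : Carrier → Carrier → Carrier
    -_      : Carrier → Carrier
    0#      : Carrier
    1#      : Carrier
    ∂       : Carrier → Carrier

  _<_ : Rel Carrier ℓ
  x < y = x ≤ y × ¬ (x ≈ y)

module HFieldDefs {c ℓ} (F : RawODF c ℓ) where
  open RawODF F

  IsConst : Carrier → Set ℓ
  IsConst a = ∂ a ≈ 0#

  ConvC : Carrier → Set (c ⊔ ℓ)
  ConvC a = Σ[ c₁ ∈ Carrier ] Σ[ c₂ ∈ Carrier ]
              IsConst c₁ × IsConst c₂ × c₁ ≤ a × a ≤ c₂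

  MaxConvC : Carrier → Set (c ⊔ ℓ)
  MaxConvC a = ConvC a × ¬ (Σ[ b ∈ Carrier ] ConvC b × a * b ≈ 1#)

  record IsHField : Set (c ⊔ ℓ) where
    field
      pos : ∀ a → (∀ k → IsConst k → k < a) → 0# < ∂ a
      conv⊆C+𝔪 : ∀ a → ConvC a →
                   Σ[ k ∈ Carrier ] Σ[ ε ∈ Carrier ]
                     IsConst k × MaxConvC ε × a ≈ k + ε
      C+𝔪⊆conv : ∀ k ε → IsConst k → MaxConvC ε → ConvC (k + ε)

open HFieldDefs public using (IsHField)

record OrderedDifferentialField (c ℓ : Level) : Set (lsuc (c ⊔ ℓ)) where
  field
    raw : RawODF c ℓ
  open RawODF raw public
  field
    _⁻¹ : Carrier → Carrier
    isCommutativeRing : IsCommutativeRing _≈_ _+_ _*_ -_ 0# 1#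
    0≉1     : ¬ (0# ≈ 1#)
    ⁻¹-inverse : ∀ x → ¬ (x ≈ 0#) → x * (x ⁻¹) ≈ 1#
    ⁻¹-cong : ∀ {x y} → x ≈ y → (x ⁻¹) ≈ (y ⁻¹)
    isTotalOrder : IsTotalOrder _≈_ _≤_
    +-mono-≤ : ∀ {x y} z → x ≤ y → x + z ≤ y + z
    *-nonneg : ∀ {x y} → 0# ≤ x → 0# ≤ y → 0# ≤ x * y
    ∂-cong : ∀ {x y} → x ≈ y → ∂ x ≈ ∂ y
    ∂-+ : ∀ x y → ∂ (x + y) ≈ ∂ x + ∂ y
    ∂-* : ∀ x y → ∂ (x * y) ≈ ∂ x * y + x * ∂ y

  _-_ : Carrier → Carrier → Carrier
  x - y = x + (- y)

  nat : ℕ → Carrier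
  nat zero    = 0#
  nat (suc n) = 1# + nat n

module _ {c ℓ} (K : OrderedDifferentialField c ℓ) where
  open OrderedDifferentialField K

  record ValuationRing : Set (lsuc (c ⊔ ℓ)) where
    field
      𝒪      : Carrier → Set ℓ
      𝒪-resp : ∀ {x y} → x ≈ y → 𝒪 x → 𝒪 y
      𝒪-0    : 𝒪 0#
      𝒪-1    : 𝒪 1#
      𝒪-+    : ∀ {x y} → 𝒪 x → 𝒪 y → 𝒪 (x + y)
      𝒪-neg  : ∀ {x} → 𝒪 x → 𝒪 (- x)
      𝒪-*    : ∀ {x y} → 𝒪 x → 𝒪 y → 𝒪 (x * y)
      𝒪-val  : ∀ x → ¬ (x ≈ 0#) → 𝒪 x ⊎ 𝒪 (x ⁻¹)
      ℚ⊆𝒪    : ∀ n → 𝒪 (nat (suc n) ⁻¹)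

    𝔪 : Carrier → Set (c ⊔ ℓ)
    𝔪 x = 𝒪 x × ¬ (Σ[ y ∈ Carrier ] 𝒪 y × x * y ≈ 1#)

    _≼_ : Carrier → Carrier → Set (c ⊔ ℓ)
    f ≼ g = Σ[ h ∈ Carrier ] 𝒪 h × f ≈ h * g

    _≺_ : Carrier → Carrier → Set (c ⊔ ℓ)
    f ≺ g = (Σ[ h ∈ Carrier ] 𝔪 h × f ≈ h * g) × ¬ (g ≈ 0#)

    _† : Carrier → Carrier
    g † = ∂ g * (g ⁻¹)

    SmallDerivation : Set (c ⊔ ℓ)
    SmallDerivation = ∀ x → 𝔪 x → 𝔪 (∂ x)

    record IsPreHField : Set (c ⊔ ℓ) where
      field
        convex : ∀ {x y z} → 𝒪 x → 𝒪 z → x ≤ y → y ≤ z → 𝒪 y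
        pos    : ∀ f → (∀ o → 𝒪 o → o < f) → 0# < ∂ f
        dom    : ∀ f g → ¬ (f ≈ 0#) → ¬ (g ≈ 0#) → f ≼ 1# → g ≺ 1# →
                 ∂ f ≺ (g †)

    -- The residue field 𝒪/𝔪 with induced ordering and derivation, as a
    -- setoid on 𝒪 (equality: difference in 𝔪).  The derivation needs
    -- ∂𝒪 ⊆ 𝒪 (a consequence of small derivation).
    residue : (∀ {x} → 𝒪 x → 𝒪 (∂ x)) → RawODF (c ⊔ ℓ) (c ⊔ ℓ)
    residue ∂𝒪 = record
      { Carrier = Σ Carrier 𝒪
      ; _≈_ = λ a b → 𝔪 (proj₁ a - proj₁ b)
      ; _≤_ = λ a b → (proj₁ a ≤ proj₁ b) ⊎ 𝔪 (proj₁ a - proj₁ b)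
      ; _+_ = λ a b → (proj₁ a + proj₁ b , 𝒪-+ (proj₂ a) (proj₂ b))
      ; _*_ = λ a b → (proj₁ a * proj₁ b , 𝒪-* (proj₂ a) (proj₂ b))
      ; -_  = λ a → (- proj₁ a , 𝒪-neg (proj₂ a))
      ; 0#  = (0# , 𝒪-0)
      ; 1#  = (1# , 𝒪-1)
      ; ∂   = λ a → (∂ (proj₁ a) , ∂𝒪 (proj₂ a))
      }

    ResidueConstantClosed : (∂𝒪 : ∀ {x} → 𝒪 x → 𝒪 (∂ x)) → Set (c ⊔ ℓ)
    ResidueConstantClosed ∂𝒪 =
      ∀ (ȧ : RawODF.Carrier (residue ∂𝒪)) →
        HFieldDefs.IsConst (residue ∂𝒪) ȧ →
        Σ[ k ∈ Carrier ] Σ[ ok ∈ 𝒪 k ] (∂ k ≈ 0#) ×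
          RawODF._≈_ (residue ∂𝒪) (k , ok) ȧ

{-# OPTIONS --safe #-}
module Submission where

open import Defs
open import Level using (_⊔_)
open import Function using (_∘_)
open import Data.Product using (Σ-syntax; _×_; _,_; proj₁; proj₂)
open import Data.Sum using (_⊎_; inj₁; inj₂; [_,_]′)
open import Data.Empty using (⊥-elim)
open import Relation.Nullary using (¬_)
open import Relation.Nullary.Negation using (¬¬-map)
open import Relation.Binary.Structures using (IsTotalOrder)
open import Algebra.Bundles using (CommutativeRing)
import Algebra.Properties.Ring as RingProperties
import Algebra.Properties.CommutativeSemigroup as CommutativeSemigroupProperties
import Relation.Binary.Reasoning.Setoid as SetoidReasoning

-- Constants of K lie in 𝒪: if c ∉ 𝒪 then ±c > 𝒪, and the pre-H-field axiom
-- would give c' ≠ 0.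
-- Axiom (i): let a > C. If a ∉ 𝒪 then a > 𝒪, so a' > 0 by the pre-H-field
-- axiom. If a ∈ 𝒪, every constant of K̇ is the residue of some k ∈ C, and
-- k + 1 < a puts the residue of a above it; so the H-field K̇ gives a' > 0
-- modulo 𝔪, hence a' > 0.
-- Axiom (ii): given constants c₁ ≤ a ≤ c₂, the constant D = c₂ − c₁ + 1
-- rescales a to b = D⁻¹(a − c₁) ∈ [0, 1] ⊆ 𝒪. In K̇ the residue of b is a
-- constant plus a non-unit of conv(C_K̇); lifting the constant to k₀ ∈ C gives
-- a = (c₁ + D k₀) + D (b − k₀), and D (b − k₀) is a non-unit of conv(C_K)
-- because the residue of b − k₀ is a non-unit of conv(C_K̇).
-- Membership in 𝒪 is not decidable, so "c ∈ 𝒪" and the case split on a ∈ 𝒪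
-- are only available under ¬¬; that suffices, as the goals they serve are
-- negations or ¬¬-stable.

module _ {c ℓ} (K : OrderedDifferentialField c ℓ) where
  open OrderedDifferentialField K
  open HFieldDefs raw using (IsConst; ConvC; MaxConvC)
  open IsTotalOrder isTotalOrder using (total; antisym; ≤-respˡ-≈; ≤-respʳ-≈)
    renaming (trans to ≤-trans)

  commutativeRing : CommutativeRing c ℓ
  commutativeRing = record
    { Carrier = Carrier ; _≈_ = _≈_ ; _+_ = _+_ ; _*_ = _*_ ; -_ = -_
    ; 0# = 0# ; 1# = 1# ; isCommutativeRing = isCommutativeRing }

  open CommutativeRing commutativeRing
    using ( setoid; ring; +-commutativeSemigroup
          ; +-cong; +-congˡ; +-congʳ; *-congˡ; *-congʳ
          ; +-comm; *-comm; +-assoc; *-assoc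
          ; +-identityˡ; +-identityʳ; *-identityˡ; *-identityʳ
          ; -‿inverseʳ; zeroˡ; zeroʳ; distribˡ; distribʳ )
    renaming (sym to ≈-sym; trans to ≈-trans)
  open RingProperties ring
    using ( -‿distribˡ-*; -‿distribʳ-*; -‿involutive; -‿+-comm; -1*x≈-x
          ; x+x≈x⇒x≈0; x[y-z]≈xy-xz; [y-z]x≈yx-zx
          ; x≈y⇒x∙y⁻¹≈ε; ⁻¹-anti-homo‿-; xyx⁻¹≈y
          ; //-rightDividesˡ; \\-leftDividesʳ )
  open CommutativeSemigroupProperties +-commutativeSemigroup using (interchange)
  open SetoidReasoning setoid

  InvertibleIn : ∀ {p} → (Carrier → Set p) → Carrier → Set (c ⊔ ℓ ⊔ p)
  InvertibleIn S x = Σ[ y ∈ Carrier ] S y × x * y ≈ 1#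

  InvertibleIn-resp-≈ : ∀ {p} {S : Carrier → Set p} {x y} →
                        x ≈ y → InvertibleIn S x → InvertibleIn S y
  InvertibleIn-resp-≈ x≈y (z , z∈S , xz≈1) = z , z∈S , ≈-trans (*-congʳ (≈-sym x≈y)) xz≈1

  ⁻¹-inverseˡ : ∀ {x} → ¬ x ≈ 0# → x ⁻¹ * x ≈ 1#
  ⁻¹-inverseˡ {x} x≉0 = ≈-trans (*-comm (x ⁻¹) x) (⁻¹-inverse x x≉0)

  x*[x⁻¹*y]≈y : ∀ {x} → ¬ x ≈ 0# → ∀ y → x * (x ⁻¹ * y) ≈ y
  x*[x⁻¹*y]≈y {x} x≉0 y = begin
    x * (x ⁻¹ * y)  ≈⟨ *-assoc x (x ⁻¹) y ⟨
    x * x ⁻¹ * y    ≈⟨ *-congʳ (⁻¹-inverse x x≉0) ⟩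
    1# * y          ≈⟨ *-identityˡ y ⟩
    y               ∎

  x⁻¹*[x*y]≈y : ∀ {x} → ¬ x ≈ 0# → ∀ y → x ⁻¹ * (x * y) ≈ y
  x⁻¹*[x*y]≈y {x} x≉0 y = begin
    x ⁻¹ * (x * y)  ≈⟨ *-assoc (x ⁻¹) x y ⟨
    x ⁻¹ * x * y    ≈⟨ *-congʳ (⁻¹-inverseˡ x≉0) ⟩
    1# * y          ≈⟨ *-identityˡ y ⟩
    y               ∎

  d*b≈a-c⇒c+d*k+d*[b-k]≈a : ∀ {a b c d k} → d * b ≈ a - c → (c + d * k) + d * (b - k) ≈ a
  d*b≈a-c⇒c+d*k+d*[b-k]≈a {a} {b} {c} {d} {k} d*b≈a-c = begin
    (c + d * k) + d * (b - k)  ≈⟨ +-assoc c (d * k) (d * (b - k)) ⟩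
    c + (d * k + d * (b - k))  ≈⟨ +-congˡ (distribˡ d k (b - k)) ⟨
    c + d * (k + (b - k))      ≈⟨ +-congˡ (*-congˡ (≈-trans (+-comm k (b - k)) (//-rightDividesˡ k b))) ⟩
    c + d * b                  ≈⟨ +-congˡ d*b≈a-c ⟩
    c + (a - c)                ≈⟨ +-comm c (a - c) ⟩
    (a - c) + c                ≈⟨ //-rightDividesˡ c a ⟩
    a                          ∎

  +-monoʳ-≤ : ∀ z {x y} → x ≤ y → z + x ≤ z + y
  +-monoʳ-≤ z {x} {y} x≤y = ≤-respˡ-≈ (+-comm x z) (≤-respʳ-≈ (+-comm y z) (+-mono-≤ z x≤y))

  x≤y⇒0≤y-x : ∀ {x y} → x ≤ y → 0# ≤ y - x
  x≤y⇒0≤y-x {x} x≤y = ≤-respˡ-≈ (-‿inverseʳ x) (+-mono-≤ (- x) x≤y)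

  0≤y-x⇒x≤y : ∀ {x y} → 0# ≤ y - x → x ≤ y
  0≤y-x⇒x≤y {x} {y} 0≤y-x =
    ≤-respˡ-≈ (+-identityˡ x) (≤-respʳ-≈ (//-rightDividesˡ x y) (+-mono-≤ x 0≤y-x))

  0≤1 : 0# ≤ 1#
  0≤1 with total 0# 1#
  ... | inj₁ 0≤1 = 0≤1
  ... | inj₂ 1≤0 = ≤-respʳ-≈ (≈-trans (-1*x≈-x (- 1#)) (-‿involutive 1#)) (*-nonneg 0≤-1 0≤-1)
    where
    0≤-1 : 0# ≤ - 1#
    0≤-1 = ≤-respʳ-≈ (+-identityˡ (- 1#)) (≤-respˡ-≈ (-‿inverseʳ 1#) (+-mono-≤ (- 1#) 1≤0))

  1≰0 : ¬ 1# ≤ 0#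
  1≰0 1≤0 = 0≉1 (antisym 0≤1 1≤0)

  x≤x+1 : ∀ x → x ≤ x + 1#
  x≤x+1 x = ≤-respˡ-≈ (+-identityʳ x) (+-monoʳ-≤ x 0≤1)

  *-monoʳ-≤-nonNeg : ∀ {x y z} → 0# ≤ z → x ≤ y → z * x ≤ z * y
  *-monoʳ-≤-nonNeg {x} {y} {z} 0≤z x≤y =
    0≤y-x⇒x≤y (≤-respʳ-≈ (x[y-z]≈xy-xz z y x) (*-nonneg 0≤z (x≤y⇒0≤y-x x≤y)))

  1≤x⇒x≉0 : ∀ {x} → 1# ≤ x → ¬ x ≈ 0#
  1≤x⇒x≉0 1≤x x≈0 = 1≰0 (≤-respʳ-≈ x≈0 1≤x)

  1≤x⇒0≤x⁻¹ : ∀ {x} → 1# ≤ x → 0# ≤ x ⁻¹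
  1≤x⇒0≤x⁻¹ {x} 1≤x with total 0# (x ⁻¹)
  ... | inj₁ 0≤x⁻¹ = 0≤x⁻¹
  ... | inj₂ x⁻¹≤0 = ⊥-elim (1≰0 (≤-respˡ-≈ (⁻¹-inverse x (1≤x⇒x≉0 1≤x))
                                   (≤-respʳ-≈ (zeroʳ x) (*-monoʳ-≤-nonNeg (≤-trans 0≤1 1≤x) x⁻¹≤0))))

  x≤y⇒y⁻¹*x≤1 : ∀ {x y} → 1# ≤ y → x ≤ y → y ⁻¹ * x ≤ 1#
  x≤y⇒y⁻¹*x≤1 1≤y x≤y =
    ≤-respʳ-≈ (⁻¹-inverseˡ (1≤x⇒x≉0 1≤y)) (*-monoʳ-≤-nonNeg (1≤x⇒0≤x⁻¹ 1≤y) x≤y)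

  1≤x⇒x⁻¹≤1 : ∀ {x} → 1# ≤ x → x ⁻¹ ≤ 1#
  1≤x⇒x⁻¹≤1 {x} 1≤x = ≤-respˡ-≈ (*-identityʳ (x ⁻¹)) (x≤y⇒y⁻¹*x≤1 1≤x 1≤x)

  <-stable : ∀ {x y} → ¬ ¬ (x < y) → x < y
  <-stable {x} {y} ¬¬x<y with total x y
  ... | inj₁ x≤y = x≤y , λ x≈y → ¬¬x<y (λ x<y → proj₂ x<y x≈y)
  ... | inj₂ y≤x = ⊥-elim (¬¬x<y (λ x<y → proj₂ x<y (antisym (proj₁ x<y) y≤x)))

  const-0 : IsConst 0#
  const-0 = x+x≈x⇒x≈0 (∂ 0#) (≈-trans (≈-sym (∂-+ 0# 0#)) (∂-cong (+-identityˡ 0#)))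

  const-1 : IsConst 1#
  const-1 = x+x≈x⇒x≈0 (∂ 1#) (begin
    ∂ 1# + ∂ 1#            ≈⟨ +-cong (*-identityʳ (∂ 1#)) (*-identityˡ (∂ 1#)) ⟨
    ∂ 1# * 1# + 1# * ∂ 1#  ≈⟨ ∂-* 1# 1# ⟨
    ∂ (1# * 1#)            ≈⟨ ∂-cong (*-identityʳ 1#) ⟩
    ∂ 1#                   ∎)

  const-+ : ∀ {x y} → IsConst x → IsConst y → IsConst (x + y)
  const-+ {x} {y} x-const y-const =
    ≈-trans (∂-+ x y) (≈-trans (+-cong x-const y-const) (+-identityʳ 0#))

  const-neg : ∀ {x} → IsConst x → IsConst (- x)
  const-neg {x} x-const = begin
    ∂ (- x)          ≈⟨ +-identityˡ (∂ (- x)) ⟨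
    0# + ∂ (- x)     ≈⟨ +-congʳ x-const ⟨
    ∂ x + ∂ (- x)    ≈⟨ ∂-+ x (- x) ⟨
    ∂ (x - x)        ≈⟨ ∂-cong (-‿inverseʳ x) ⟩
    ∂ 0#             ≈⟨ const-0 ⟩
    0#               ∎

  const-* : ∀ {x y} → IsConst x → IsConst y → IsConst (x * y)
  const-* {x} {y} x-const y-const = begin
    ∂ (x * y)          ≈⟨ ∂-* x y ⟩
    ∂ x * y + x * ∂ y  ≈⟨ +-cong (*-congʳ x-const) (*-congˡ y-const) ⟩
    0# * y + x * 0#    ≈⟨ +-cong (zeroˡ y) (zeroʳ x) ⟩
    0# + 0#            ≈⟨ +-identityʳ 0# ⟩
    0#                 ∎

  ConvC-resp-≈ : ∀ {x y} → x ≈ y → ConvC x → ConvC y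
  ConvC-resp-≈ x≈y (c₁ , c₂ , c₁-const , c₂-const , c₁≤x , x≤c₂) =
    c₁ , c₂ , c₁-const , c₂-const , ≤-respʳ-≈ x≈y c₁≤x , ≤-respˡ-≈ x≈y x≤c₂

  [0,1]⊆ConvC : ∀ {x} → 0# ≤ x → x ≤ 1# → ConvC x
  [0,1]⊆ConvC 0≤x x≤1 = 0# , 1# , const-0 , const-1 , 0≤x , x≤1

  const+ConvC : ∀ {k x} → IsConst k → ConvC x → ConvC (k + x)
  const+ConvC {k} k-const (c₁ , c₂ , c₁-const , c₂-const , c₁≤x , x≤c₂) =
    k + c₁ , k + c₂ , const-+ k-const c₁-const , const-+ k-const c₂-const ,
    +-monoʳ-≤ k c₁≤x , +-monoʳ-≤ k x≤c₂

  nonNeg-const*ConvC : ∀ {d x} → IsConst d → 0# ≤ d → ConvC x → ConvC (d * x)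
  nonNeg-const*ConvC {d} d-const 0≤d (c₁ , c₂ , c₁-const , c₂-const , c₁≤x , x≤c₂) =
    d * c₁ , d * c₂ , const-* d-const c₁-const , const-* d-const c₂-const ,
    *-monoʳ-≤-nonNeg 0≤d c₁≤x , *-monoʳ-≤-nonNeg 0≤d x≤c₂

  InvertibleIn-ConvC-cancel-nonNeg-constˡ : ∀ {d x} → IsConst d → 0# ≤ d →
                                     InvertibleIn ConvC (d * x) → InvertibleIn ConvC x
  InvertibleIn-ConvC-cancel-nonNeg-constˡ {d} {x} d-const 0≤d (β , β-conv , dxβ≈1) =
    d * β , nonNeg-const*ConvC d-const 0≤d β-conv ,
    ≈-trans (≈-sym (*-assoc x d β)) (≈-trans (*-congʳ (*-comm x d)) dxβ≈1)

  module _ (V : ValuationRing K) where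
    open ValuationRing V

    𝔪-resp-≈ : ∀ {x y} → x ≈ y → 𝔪 x → 𝔪 y
    𝔪-resp-≈ x≈y (x∈𝒪 , x-nonunit) = 𝒪-resp x≈y x∈𝒪 , x-nonunit ∘ InvertibleIn-resp-≈ (≈-sym x≈y)

    𝔪-0 : 𝔪 0#
    𝔪-0 = 𝒪-0 , λ (z , _ , 0z≈1) → 0≉1 (≈-trans (≈-sym (zeroˡ z)) 0z≈1)

    𝔪-neg : ∀ {x} → 𝔪 x → 𝔪 (- x)
    𝔪-neg {x} (x∈𝒪 , x-nonunit) = 𝒪-neg x∈𝒪 , λ (z , z∈𝒪 , -x*z≈1) →
      x-nonunit (- z , 𝒪-neg z∈𝒪 , ≈-trans (≈-trans (≈-sym (-‿distribʳ-* x z)) (-‿distribˡ-* x z)) -x*z≈1)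

    𝔪-*-𝒪 : ∀ {x y} → 𝔪 x → 𝒪 y → 𝔪 (x * y)
    𝔪-*-𝒪 {x} {y} (x∈𝒪 , x-nonunit) y∈𝒪 = 𝒪-* x∈𝒪 y∈𝒪 , λ (z , z∈𝒪 , xyz≈1) →
      x-nonunit (y * z , 𝒪-* y∈𝒪 z∈𝒪 , ≈-trans (≈-sym (*-assoc x y z)) xyz≈1)

    ≼-total : ∀ {x y} → ¬ x ≈ 0# → ¬ y ≈ 0# → y ≼ x ⊎ x ≼ y
    ≼-total {x} {y} x≉0 y≉0 =
      [ (λ h∈𝒪 → inj₁ (h , h∈𝒪 , ≈-sym h*x≈y))
      , (λ h⁻¹∈𝒪 → inj₂ (h ⁻¹ , h⁻¹∈𝒪 , ≈-trans (≈-sym (x⁻¹*[x*y]≈y h≉0 x)) (*-congˡ h*x≈y)))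
      ]′ (𝒪-val h h≉0)
      where
      h : Carrier
      h = x ⁻¹ * y
      h*x≈y : h * x ≈ y
      h*x≈y = ≈-trans (*-comm h x) (x*[x⁻¹*y]≈y x≉0 y)
      h≉0 : ¬ h ≈ 0#
      h≉0 h≈0 = y≉0 (≈-trans (≈-sym h*x≈y) (≈-trans (*-congʳ h≈0) (zeroˡ x)))

    𝔪-+-≼ : ∀ {x y} → 𝔪 x → y ≼ x → ¬ InvertibleIn 𝒪 (x + y)
    𝔪-+-≼ {x} {y} (_ , x-nonunit) (h , h∈𝒪 , y≈hx) (z , z∈𝒪 , [x+y]z≈1) =
      x-nonunit ((1# + h) * z , 𝒪-* (𝒪-+ 𝒪-1 h∈𝒪) z∈𝒪 , (begin
        x * ((1# + h) * z)      ≈⟨ *-assoc x (1# + h) z ⟨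
        x * (1# + h) * z        ≈⟨ *-congʳ (*-comm x (1# + h)) ⟩
        (1# + h) * x * z        ≈⟨ *-congʳ (distribʳ x 1# h) ⟩
        (1# * x + h * x) * z    ≈⟨ *-congʳ (+-cong (*-identityˡ x) (≈-sym y≈hx)) ⟩
        (x + y) * z             ≈⟨ [x+y]z≈1 ⟩
        1#                      ∎))

    𝔪-+ : ∀ {x y} → 𝔪 x → 𝔪 y → 𝔪 (x + y)
    𝔪-+ {x} {y} x∈𝔪 y∈𝔪 = 𝒪-+ (proj₁ x∈𝔪) (proj₁ y∈𝔪) , x+y-nonunit
      where
      x+y-nonunit : ¬ InvertibleIn 𝒪 (x + y)
      x+y-nonunit x+y-unit =
        [ (λ y≼x → 𝔪-+-≼ x∈𝔪 y≼x x+y-unit)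
        , (λ x≼y → 𝔪-+-≼ y∈𝔪 x≼y (InvertibleIn-resp-≈ (+-comm x y) x+y-unit))
        ]′ (≼-total x≉0 y≉0)
        where
        x≉0 : ¬ x ≈ 0#
        x≉0 x≈0 = proj₂ y∈𝔪 (InvertibleIn-resp-≈ (≈-trans (+-congʳ x≈0) (+-identityˡ y)) x+y-unit)
        y≉0 : ¬ y ≈ 0#
        y≉0 y≈0 = proj₂ x∈𝔪 (InvertibleIn-resp-≈ (≈-trans (+-congˡ y≈0) (+-identityʳ x)) x+y-unit)

    infix 4 _~_
    _~_ : Carrier → Carrier → Set (c ⊔ ℓ)
    x ~ y = 𝔪 (x - y)

    ≈⇒~ : ∀ {x y} → x ≈ y → x ~ y
    ≈⇒~ x≈y = 𝔪-resp-≈ (≈-sym (x≈y⇒x∙y⁻¹≈ε x≈y)) 𝔪-0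

    ~-sym : ∀ {x y} → x ~ y → y ~ x
    ~-sym {x} {y} x~y = 𝔪-resp-≈ (⁻¹-anti-homo‿- x y) (𝔪-neg x~y)

    ~-trans : ∀ {x y z} → x ~ y → y ~ z → x ~ z
    ~-trans {x} {y} {z} x~y y~z = 𝔪-resp-≈ x-y+[y-z]≈x-z (𝔪-+ x~y y~z)
      where
      x-y+[y-z]≈x-z : (x - y) + (y - z) ≈ x - z
      x-y+[y-z]≈x-z = ≈-trans (+-assoc x (- y) (y - z)) (+-congˡ (\\-leftDividesʳ y (- z)))

    ~-−-cong : ∀ {x x′ y y′} → x ~ x′ → y ~ y′ → (x - y) ~ (x′ - y′)
    ~-−-cong {x} {x′} {y} {y′} x~x′ y~y′ = 𝔪-resp-≈ rearrange (𝔪-+ x~x′ (𝔪-neg y~y′))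
      where
      rearrange : (x - x′) + - (y - y′) ≈ (x - y) - (x′ - y′)
      rearrange = begin
        (x - x′) + - (y - y′)      ≈⟨ +-congˡ (-‿+-comm y (- y′)) ⟨
        (x - x′) + (- y + - - y′)  ≈⟨ interchange x (- x′) (- y) (- - y′) ⟩
        (x - y) + (- x′ + - - y′)  ≈⟨ +-congˡ (-‿+-comm x′ (- y′)) ⟩
        (x - y) - (x′ - y′)        ∎

    ~-*-𝒪 : ∀ {x x′ z} → x ~ x′ → 𝒪 z → (x * z) ~ (x′ * z)
    ~-*-𝒪 {x} {x′} {z} x~x′ z∈𝒪 = 𝔪-resp-≈ ([y-z]x≈yx-zx z x x′) (𝔪-*-𝒪 x~x′ z∈𝒪)

    residue-<⇒< : ∀ {x y} → (x ≤ y ⊎ x ~ y) × ¬ x ~ y → x < y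
    residue-<⇒< (inj₁ x≤y , x≁y) = x≤y , x≁y ∘ ≈⇒~
    residue-<⇒< (inj₂ x~y , x≁y) = ⊥-elim (x≁y x~y)

    module Convex (convex : ∀ {x y z} → 𝒪 x → 𝒪 z → x ≤ y → y ≤ z → 𝒪 y) where

      [0,1]⊆𝒪 : ∀ {x} → 0# ≤ x → x ≤ 1# → 𝒪 x
      [0,1]⊆𝒪 = convex 𝒪-0 𝒪-1

      𝔪⇒1≰ : ∀ {x} → 𝔪 x → ¬ 1# ≤ x
      𝔪⇒1≰ {x} (_ , x-nonunit) 1≤x =
        x-nonunit (x ⁻¹ , [0,1]⊆𝒪 (1≤x⇒0≤x⁻¹ 1≤x) (1≤x⇒x⁻¹≤1 1≤x) , ⁻¹-inverse x (1≤x⇒x≉0 1≤x))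

      +1≤⇒≁ : ∀ {p q} → p + 1# ≤ q → ¬ q ~ p
      +1≤⇒≁ {p} p+1≤q q~p = 𝔪⇒1≰ q~p (≤-respˡ-≈ (xyx⁻¹≈y p 1#) (+-mono-≤ (- p) p+1≤q))

      +1≤⇒residue-< : ∀ {k k₀ a} → k ~ k₀ → k₀ + 1# ≤ a → (k ≤ a ⊎ k ~ a) × ¬ k ~ a
      +1≤⇒residue-< {k} {k₀} {a} k~k₀ k₀+1≤a =
        [ inj₁ , (λ a≤k → ⊥-elim (+1≤⇒≁ (≤-trans k₀+1≤a a≤k) k~k₀)) ]′ (total k a) ,
        λ k~a → +1≤⇒≁ k₀+1≤a (~-trans (~-sym k~a) k~k₀)

      ¬𝒪⇒>𝒪 : ∀ {a} → 0# ≤ a → ¬ 𝒪 a → ∀ o → 𝒪 o → o < a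
      ¬𝒪⇒>𝒪 {a} 0≤a a∉𝒪 o o∈𝒪 with total o a
      ... | inj₁ o≤a = o≤a , λ o≈a → a∉𝒪 (𝒪-resp o≈a o∈𝒪)
      ... | inj₂ a≤o = ⊥-elim (a∉𝒪 (convex 𝒪-0 o∈𝒪 0≤a a≤o))

    module _ (preH : IsPreHField) where
      open IsPreHField preH using (convex) renaming (pos to pos-above-𝒪)
      open Convex convex

      nonNeg-const⇒¬¬𝒪 : ∀ {x} → 0# ≤ x → IsConst x → ¬ ¬ 𝒪 x
      nonNeg-const⇒¬¬𝒪 {x} 0≤x x-const x∉𝒪 =
        proj₂ (pos-above-𝒪 x (¬𝒪⇒>𝒪 0≤x x∉𝒪)) (≈-sym x-const)

      const⇒¬¬𝒪 : ∀ {x} → IsConst x → ¬ ¬ 𝒪 x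
      const⇒¬¬𝒪 {x} x-const with total 0# x
      ... | inj₁ 0≤x = nonNeg-const⇒¬¬𝒪 0≤x x-const
      ... | inj₂ x≤0 = ¬¬-map (𝒪-resp (-‿involutive x) ∘ 𝒪-neg)
                              (nonNeg-const⇒¬¬𝒪 0≤-x (const-neg x-const))
        where
        0≤-x : 0# ≤ - x
        0≤-x = ≤-respʳ-≈ (+-identityˡ (- x)) (x≤y⇒0≤y-x x≤0)

      module _ (∂𝒪 : ∀ {x} → 𝒪 x → 𝒪 (∂ x)) (rcc : ResidueConstantClosed ∂𝒪)
               (K̇-isHField : IsHField (residue ∂𝒪)) where
        private
          module K̇ where
            open RawODF (residue ∂𝒪) public
            open HFieldDefs (residue ∂𝒪) public
          module K̇-H = HFieldDefs.IsHField K̇-isHField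

        residue-above-constants : ∀ {a} (a∈𝒪 : 𝒪 a) → (∀ k → IsConst k → k < a) →
                                  ∀ k̇ → K̇.IsConst k̇ → k̇ K̇.< (a , a∈𝒪)
        residue-above-constants a∈𝒪 a>C k̇ k̇-const =
          let (k₀ , _ , k₀-const , k₀~k̇) = rcc k̇ k̇-const
          in +1≤⇒residue-< (~-sym k₀~k̇) (proj₁ (a>C (k₀ + 1#) (const-+ k₀-const const-1)))

        𝒪-above-constants⇒∂-pos : ∀ {a} → 𝒪 a → (∀ k → IsConst k → k < a) → 0# < ∂ a
        𝒪-above-constants⇒∂-pos a∈𝒪 a>C =
          residue-<⇒< (K̇-H.pos (_ , a∈𝒪) (residue-above-constants a∈𝒪 a>C))

        above-constants⇒∂-pos : ∀ a → (∀ k → IsConst k → k < a) → 0# < ∂ a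
        above-constants⇒∂-pos a a>C = <-stable λ ∂a≯0 →
          let a∉𝒪 = λ a∈𝒪 → ∂a≯0 (𝒪-above-constants⇒∂-pos a∈𝒪 a>C)
          in ∂a≯0 (pos-above-𝒪 a (¬𝒪⇒>𝒪 (proj₁ (a>C 0# const-0)) a∉𝒪))

        [0,1]⊆residue-ConvC : ∀ {x} (x∈𝒪 : 𝒪 x) → 0# ≤ x → x ≤ 1# → K̇.ConvC (x , x∈𝒪)
        [0,1]⊆residue-ConvC x∈𝒪 0≤x x≤1 =
          (0# , 𝒪-0) , (1# , 𝒪-1) , ≈⇒~ const-0 , ≈⇒~ const-1 , inj₁ 0≤x , inj₁ x≤1

        ConvC⇒¬¬residue-ConvC : ∀ {x} → ConvC x → ¬ ¬ (Σ[ x∈𝒪 ∈ 𝒪 x ] K̇.ConvC (x , x∈𝒪))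
        ConvC⇒¬¬residue-ConvC (c₁ , c₂ , c₁-const , c₂-const , c₁≤x , x≤c₂) no =
          const⇒¬¬𝒪 c₁-const λ c₁∈𝒪 → const⇒¬¬𝒪 c₂-const λ c₂∈𝒪 →
            no (convex c₁∈𝒪 c₂∈𝒪 c₁≤x x≤c₂ ,
                (c₁ , c₁∈𝒪) , (c₂ , c₂∈𝒪) , ≈⇒~ c₁-const , ≈⇒~ c₂-const , inj₁ c₁≤x , inj₁ x≤c₂)

        residue-MaxConvC⇒¬InvertibleIn-ConvC : ∀ {t} (ε̇ : K̇.Carrier) → K̇.MaxConvC ε̇ →
                                               t ~ proj₁ ε̇ → ¬ InvertibleIn ConvC t
        residue-MaxConvC⇒¬InvertibleIn-ConvC ε̇ (_ , ε̇-nonunit) t~ε̇ (γ , γ-conv , tγ≈1) =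
          ConvC⇒¬¬residue-ConvC γ-conv λ (γ∈𝒪 , γ̇-conv) →
            ε̇-nonunit ((γ , γ∈𝒪) , γ̇-conv , ~-trans (~-*-𝒪 (~-sym t~ε̇) γ∈𝒪) (≈⇒~ tγ≈1))

        lift-residue-decomposition : ∀ {b} (b∈𝒪 : 𝒪 b) → K̇.ConvC (b , b∈𝒪) →
                                     Σ[ k₀ ∈ Carrier ] IsConst k₀ × ¬ InvertibleIn ConvC (b - k₀)
        lift-residue-decomposition b∈𝒪 ḃ-conv =
          let (k̇@(k , _) , ε̇@(ε , _) , k̇-const , ε̇-max , b~k+ε) = K̇-H.conv⊆C+𝔪 (_ , b∈𝒪) ḃ-conv
              (k₀ , _ , k₀-const , k₀~k) = rcc k̇ k̇-const
              b-k₀~ε = ~-trans (~-−-cong b~k+ε k₀~k) (≈⇒~ (xyx⁻¹≈y k ε))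
          in k₀ , k₀-const , residue-MaxConvC⇒¬InvertibleIn-ConvC ε̇ ε̇-max b-k₀~ε

        ConvC⊆C+MaxConvC : ∀ a → ConvC a →
                           Σ[ k ∈ Carrier ] Σ[ ε ∈ Carrier ] IsConst k × MaxConvC ε × a ≈ k + ε
        ConvC⊆C+MaxConvC a (c₁ , c₂ , c₁-const , c₂-const , c₁≤a , a≤c₂) =
          let (k₀ , k₀-const , b-k₀-nonunit) =
                lift-residue-decomposition b∈𝒪 ([0,1]⊆residue-ConvC b∈𝒪 0≤b b≤1)
              b-k₀-conv = ConvC-resp-≈ (+-comm (- k₀) b)
                            (const+ConvC (const-neg k₀-const) ([0,1]⊆ConvC 0≤b b≤1))
          in c₁ + D * k₀ , D * (b - k₀) , const-+ c₁-const (const-* D-const k₀-const) ,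
             (nonNeg-const*ConvC D-const 0≤D b-k₀-conv ,
              b-k₀-nonunit ∘ InvertibleIn-ConvC-cancel-nonNeg-constˡ D-const 0≤D) ,
             ≈-sym (d*b≈a-c⇒c+d*k+d*[b-k]≈a (x*[x⁻¹*y]≈y (1≤x⇒x≉0 1≤D) (a - c₁)))
          where
          D : Carrier
          D = (c₂ - c₁) + 1#
          D-const : IsConst D
          D-const = const-+ (const-+ c₂-const (const-neg c₁-const)) const-1
          1≤D : 1# ≤ D
          1≤D = ≤-respˡ-≈ (+-identityˡ 1#) (+-mono-≤ 1# (x≤y⇒0≤y-x (≤-trans c₁≤a a≤c₂)))
          0≤D : 0# ≤ D
          0≤D = ≤-trans 0≤1 1≤D
          b : Carrier
          b = D ⁻¹ * (a - c₁)
          0≤b : 0# ≤ b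
          0≤b = *-nonneg (1≤x⇒0≤x⁻¹ 1≤D) (x≤y⇒0≤y-x c₁≤a)
          b≤1 : b ≤ 1#
          b≤1 = x≤y⇒y⁻¹*x≤1 1≤D (≤-trans (+-mono-≤ (- c₁) a≤c₂) (x≤x+1 (c₂ - c₁)))
          b∈𝒪 : 𝒪 b
          b∈𝒪 = [0,1]⊆𝒪 0≤b b≤1

lemma3p7 : ∀ {c ℓ} (K : OrderedDifferentialField c ℓ) (V : ValuationRing K) →
    let open OrderedDifferentialField K
        open ValuationRing V
    in IsPreHField →
       SmallDerivation →
       (∂𝒪 : ∀ {x} → 𝒪 x → 𝒪 (∂ x)) →
       ResidueConstantClosed ∂𝒪 →
       IsHField (residue ∂𝒪) →
       IsHField raw
-- Smallness of the derivation matters only through ∂𝒪, which is supplied separately.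
lemma3p7 K V preH _ ∂𝒪 rcc K̇-isHField = record
  { pos       = above-constants⇒∂-pos K V preH ∂𝒪 rcc K̇-isHField
  ; conv⊆C+𝔪 = ConvC⊆C+MaxConvC K V preH ∂𝒪 rcc K̇-isHField
  ; C+𝔪⊆conv = λ _ _ k-const ε-max → const+ConvC K k-const (proj₁ ε-max)
  }
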